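{- Let $G\in\mathcal{C}^*_k$. Then every copy of $G_i$ (for any $i\in\mathbb{N}$) in the graph $\widehat G$ is one of the attached copies of $G_i$.
   Context: Fix pointed finite graphs $(G_i,a_i)_{i\in\mathbb{N}}$ such that each $G_i$ is 2-connected, $\{G_i\}$ is an antichain under induced embeddability (for $i\neq j$, $G_i$ is not isomorphic to an induced subgraph of $G_j$), and no automorphism of any $G_i$ moves $a_i$. A copy of $G_i$ in a graph means an induced subgraph isomorphic to $G_i$. $\mathcal{C}_k$ is the class of finite graphs with $k$ unary predicates (colors $1,\dots,k$); $\mathcal{C}^*_k\subseteq\mathcal{C}_k$ consists of those in which every vertex has exactly one color and which contain no copy of any $G_i$. For $G\in\mathcal{C}^*_k$, the graph $\widehat G$ is obtained from $G$ (forgetting colors) by, for each vertex $v$ of color $i$, taking the disjoint union with a new copy of $G_i$ and identifying $v$ with the basepoint $a_i$ of that copy; these copies are called attached copies. -}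

module Defs where

open import Data.Nat using (ℕ; _≤_)
open import Data.Fin using (Fin; toℕ; _≟_)
open import Data.Bool using (Bool; true; false; _∧_)
open import Data.Sum using (_⊎_; inj₁; inj₂)
open import Data.Product using (Σ; Σ-syntax; ∃; ∃-syntax; _×_; _,_)
open import Data.Unit using (⊤)
open import Relation.Nullary using (¬_; yes; no)
open import Relation.Nullary.Decidable using (False; ⌊_⌋; fromWitnessFalse)
open import Relation.Binary.PropositionalEquality using (_≡_; _≢_; refl)
open import Function.Definitions using (Injective; Surjective)

record FinGraph : Set where
  field
    size    : ℕ
    adj     : Fin size → Fin size → Bool
    adj-sym : ∀ u v → adj u v ≡ adj v u
    adj-irr : ∀ v → adj v v ≡ false
open FinGraph public

IsInducedEmb : {A B : Set} → (A → A → Bool) → (B → B → Bool) → (A → B) → Set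
IsInducedEmb adjA adjB f =
  Injective _≡_ _≡_ f × (∀ x y → adjB (f x) (f y) ≡ adjA x y)

Embeds : FinGraph → FinGraph → Set
Embeds H G = Σ[ f ∈ (Fin (size H) → Fin (size G)) ] IsInducedEmb (adj H) (adj G) f

IsAutomorphism : (g : FinGraph) → (Fin (size g) → Fin (size g)) → Set
IsAutomorphism g σ = IsInducedEmb (adj g) (adj g) σ × Surjective _≡_ _≡_ σ

data Walk {V : Set} (a : V → V → Bool) (P : V → Set) : V → V → Set where
  here : ∀ {u} → P u → Walk a P u u
  step : ∀ {u w v} → P u → a u w ≡ true → Walk a P w v → Walk a P u v

ConnectedOn : (g : FinGraph) → (Fin (size g) → Set) → Set
ConnectedOn g P = ∀ u v → P u → P v → Walk (adj g) P u v

TwoConnected : FinGraph → Set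
TwoConnected g =
  (3 ≤ size g) × ConnectedOn g (λ _ → ⊤) × (∀ z → ConnectedOn g (λ v → v ≢ z))

record PGraph : Set where
  field
    graph : FinGraph
    base  : Fin (size graph)
open PGraph public

Family : Set
Family = ℕ → PGraph

Antichain : Family → Set
Antichain F = ∀ i j → i ≢ j → ¬ Embeds (graph (F i)) (graph (F j))

BaseRigid : PGraph → Set
BaseRigid P = ∀ σ → IsAutomorphism (graph P) σ → σ (base P) ≡ base P

-- k-coloured graphs with exactly one colour per vertex, and the class C*_k.
-- Colour c : Fin k corresponds to the family member F (toℕ c).

record ColGraph (k : ℕ) : Set where
  field
    ugraph : FinGraph
    col    : Fin (size ugraph) → Fin k
open ColGraph public

InCstar : Family → {k : ℕ} → ColGraph k → Set
InCstar F G = ∀ i → ¬ Embeds (graph (F i)) (ugraph G)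

module Hat (F : Family) {k : ℕ} (G : ColGraph k) where

  n : ℕ
  n = size (ugraph G)

  Att : Fin n → PGraph
  Att v = F (toℕ (col G v))

  -- vertices of Ĝ: vertices of G, plus the non-basepoint vertices of
  -- each attached copy
  V : Set
  V = Fin n ⊎ (Σ[ v ∈ Fin n ] Σ[ x ∈ Fin (size (graph (Att v))) ]
                 False (x ≟ base (Att v)))

  ι : (v : Fin n) → Fin (size (graph (Att v))) → V
  ι v x with x ≟ base (Att v)
  ... | yes _ = inj₁ v
  ... | no p  = inj₂ (v , x , fromWitnessFalse p)

  adjSame : (v : Fin n) → Fin (size (graph (Att v))) → Fin (size (graph (Att v))) → Bool
  adjSame v = adj (graph (Att v))

  adjCopies : (v : Fin n) → Fin (size (graph (Att v))) →
              (w : Fin n) → Fin (size (graph (Att w))) → Bool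
  adjCopies v x w y with v ≟ w
  ... | yes refl = adjSame v x y
  ... | no _     = false

  adĵ : V → V → Bool
  adĵ (inj₁ u) (inj₁ w) = adj (ugraph G) u w
  adĵ (inj₁ u) (inj₂ (v , x , _)) = ⌊ u ≟ v ⌋ ∧ adjSame v (base (Att v)) x
  adĵ (inj₂ (v , x , _)) (inj₁ u) = ⌊ u ≟ v ⌋ ∧ adjSame v x (base (Att v))
  adĵ (inj₂ (v , x , _)) (inj₂ (w , y , _)) = adjCopies v x w y

  IsAttachedCopy : (i : ℕ) → (Fin (size (graph (F i))) → V) → Set
  IsAttachedCopy i f =
    Σ[ v ∈ Fin n ] (toℕ (col G v) ≡ i)
      × (∀ x → ∃[ y ] f x ≡ ι v y)
      × (∀ y → ∃[ x ] ι v y ≡ f x)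

-- A copy of G_i meeting the hanging part of the copy attached at v cannot
-- leave it: the only exit is the cut vertex v, and removing (the preimage of)
-- v leaves G_i connected by 2-connectivity.  So every copy lies either inside
-- G, impossible as G ∈ C*_k, or inside a single attached copy of some G_j;
-- the antichain condition forces j = i, and an injective self-map of a finite
-- set is onto, so the copy is the whole attached copy.
module Submission where

open import Defs
open import Data.Nat using (ℕ; suc)
import Data.Nat.Properties as ℕ
open import Data.Fin using (Fin; toℕ; _≟_; punchOut)
open import Data.Fin.Properties using (any?; punchOut-injective; injective⇒≤)
open import Data.Bool using (Bool; true; _∧_)
open import Data.Bool.Properties using (T-irrelevant)
open import Data.Sum using (_⊎_; inj₁; inj₂)
open import Data.Sum.Properties using (inj₁-injective)
open import Data.Product using (Σ-syntax; ∃-syntax; _×_; _,_; proj₁; proj₂)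
open import Data.Unit using (tt)
open import Data.Empty using (⊥; ⊥-elim)
open import Function using (id)
open import Function.Definitions using (Injective)
open import Relation.Nullary using (¬_; Dec; yes; no)
open import Relation.Nullary.Decidable using (False; ⌊_⌋; map′; decidable-stable; toWitnessFalse)
open import Relation.Unary using (Decidable)
open import Relation.Binary.PropositionalEquality

injective⇒surjective : ∀ {m} (h : Fin m → Fin m) → Injective _≡_ _≡_ h →
                       ∀ y → ∃[ x ] h x ≡ y
injective⇒surjective {suc m} h h-inj y with any? (λ x → h x ≟ y)
... | yes hit = hit
... | no miss = ⊥-elim (ℕ.1+n≰n (injective⇒≤ h′-inj))
  where
  h′ : Fin (suc m) → Fin m
  h′ x = punchOut {i = y} {j = h x} (λ e → miss (x , sym e))

  h′-inj : Injective _≡_ _≡_ h′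
  h′-inj {x} {x′} e =
    h-inj (punchOut-injective {i = y} (λ e′ → miss (x , sym e′)) (λ e′ → miss (x′ , sym e′)) e)

Walk-map : ∀ {A B : Set} {a : A → A → Bool} {b : B → B → Bool}
             {P : A → Set} {Q : B → Set} (f : A → B) →
           (∀ {x y} → a x y ≡ true → b (f x) (f y) ≡ true) →
           (∀ {x} → P x → Q (f x)) →
           ∀ {u w} → Walk a P u w → Walk b Q (f u) (f w)
Walk-map f edge pred (here pu)        = here (pred pu)
Walk-map f edge pred (step pu e walk) = step (pred pu) (edge e) (Walk-map f edge pred walk)

Walk-start : ∀ {A : Set} {a : A → A → Bool} {P : A → Set} {u w} → Walk a P u w → P u
Walk-start (here pu)     = pu
Walk-start (step pu _ _) = pu

TwoConnected⇒walk-avoiding : ∀ {H} → TwoConnected H →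
  (Z : Fin (size H) → Set) → Decidable Z → (∀ {z z′} → Z z → Z z′ → z ≡ z′) →
  ∀ x y → ¬ Z x → ¬ Z y → Walk (adj H) (λ w → ¬ Z w) x y
TwoConnected⇒walk-avoiding (_ , connected , connected-minus) Z Z? Z-unique x y x∉Z y∉Z
  with any? Z?
... | yes (z , z∈Z) =
  Walk-map id id (λ w≢z w∈Z → w≢z (Z-unique w∈Z z∈Z))
    (connected-minus z x y (λ x≡z → x∉Z (subst Z (sym x≡z) z∈Z))
                           (λ y≡z → y∉Z (subst Z (sym y≡z) z∈Z)))
... | no Z-empty = Walk-map id id (λ {w} _ w∈Z → Z-empty (w , w∈Z)) (connected x y tt tt)

factor-induced : ∀ {A B C : Set} {a : A → A → Bool} {b : B → B → Bool} {c : C → C → Bool}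
                   (h : B → C) {f : A → C} →
                 (∀ x y → c (h x) (h y) ≡ b x y) →
                 (∀ x → ∃[ y ] f x ≡ h y) →
                 IsInducedEmb a c f →
                 Σ[ g ∈ (A → B) ] (∀ x → f x ≡ h (g x)) × IsInducedEmb a b g
factor-induced {a = a} {b} {c} h {f} h-adj f⊆h (f-inj , f-adj) = g , f≗hg , g-inj , g-adj
  where
  g = λ x → proj₁ (f⊆h x)
  f≗hg = λ x → proj₂ (f⊆h x)

  g-inj : Injective _≡_ _≡_ g
  g-inj {x} {y} e = f-inj (trans (f≗hg x) (trans (cong h e) (sym (f≗hg y))))

  g-adj : ∀ x y → b (g x) (g y) ≡ a x y
  g-adj x y = begin
    b (g x) (g y)          ≡⟨ sym (h-adj (g x) (g y)) ⟩
    c (h (g x)) (h (g y))  ≡⟨ sym (cong₂ c (f≗hg x) (f≗hg y)) ⟩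
    c (f x) (f y)          ≡⟨ f-adj x y ⟩
    a x y                  ∎
    where open ≡-Reasoning

Antichain⇒index-≡ : ∀ {F} → Antichain F → ∀ {i j} →
                    Embeds (graph (F i)) (graph (F j)) → i ≡ j
Antichain⇒index-≡ ac {i} {j} emb = decidable-stable (i ℕ.≟ j) (λ i≢j → ac i j i≢j emb)

module HatProperties (F : Family) {k : ℕ} (G : ColGraph k) where
  open Hat F G

  Inner : Fin n → V → Set
  Inner v (inj₁ _)           = ⊥
  Inner v (inj₂ (w , _ , _)) = w ≡ v

  inner? : ∀ s → Dec (∃[ v ] Inner v s)
  inner? (inj₁ _)           = no λ ()
  inner? (inj₂ (w , _ , _)) = yes (w , refl)

  ¬inner⇒inj₁ : ∀ s → ¬ (∃[ v ] Inner v s) → ∃[ u ] s ≡ inj₁ u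
  ¬inner⇒inj₁ (inj₁ u)           _      = u , refl
  ¬inner⇒inj₁ (inj₂ (w , _ , _)) ¬inner = ⊥-elim (¬inner (w , refl))

  _≟inj₁_ : ∀ (s : V) v → Dec (s ≡ inj₁ v)
  inj₁ u ≟inj₁ v = map′ (cong inj₁) inj₁-injective (u ≟ v)
  inj₂ _ ≟inj₁ v = no λ ()

  ι-base : ∀ v → ι v (base (Att v)) ≡ inj₁ v
  ι-base v with base (Att v) ≟ base (Att v)
  ... | yes _ = refl
  ... | no b≢b = ⊥-elim (b≢b refl)

  -- `with` on x ≟ base cannot abstract the proof stored in inj₂ (v , x , p),
  -- so ι is compared with inj₂ only after that proof is forgotten.
  forget-proof : V → Fin n ⊎ Σ[ v ∈ Fin n ] Fin (size (graph (Att v)))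
  forget-proof (inj₁ u)           = inj₁ u
  forget-proof (inj₂ (v , x , _)) = inj₂ (v , x)

  forget-proof-injective : ∀ {s t} → forget-proof s ≡ forget-proof t → s ≡ t
  forget-proof-injective {inj₁ _}           {inj₁ _}           refl = refl
  forget-proof-injective {inj₂ (v , x , p)} {inj₂ (_ , _ , q)} refl =
    cong (λ r → inj₂ (v , x , r)) (T-irrelevant p q)

  forget-proof-ι : ∀ v x → x ≢ base (Att v) → forget-proof (ι v x) ≡ inj₂ (v , x)
  forget-proof-ι v x x≢b with x ≟ base (Att v)
  ... | yes x≡b = ⊥-elim (x≢b x≡b)
  ... | no _    = refl

  ι-inner : ∀ v x (p : False (x ≟ base (Att v))) → inj₂ (v , x , p) ≡ ι v x
  ι-inner v x p = forget-proof-injective (sym (forget-proof-ι v x (toWitnessFalse p)))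

  inner⇒attached : ∀ {v} s → Inner v s → ∃[ x ] s ≡ ι v x
  inner⇒attached (inj₂ (v , x , p)) refl = x , ι-inner v x p

  ⌊v≟v⌋∧ : ∀ (v : Fin n) b → ⌊ v ≟ v ⌋ ∧ b ≡ b
  ⌊v≟v⌋∧ v b with v ≟ v
  ... | yes _  = refl
  ... | no v≢v = ⊥-elim (v≢v refl)

  adjCopies-diagonal : ∀ v x y → adjCopies v x v y ≡ adjSame v x y
  adjCopies-diagonal v x y with v ≟ v
  ... | yes refl = refl
  ... | no v≢v   = ⊥-elim (v≢v refl)

  ι-adj : ∀ v x y → adĵ (ι v x) (ι v y) ≡ adj (graph (Att v)) x y
  ι-adj v x y with x ≟ base (Att v) | y ≟ base (Att v)
  ... | yes refl | yes refl = trans (adj-irr (ugraph G) v) (sym (adj-irr (graph (Att v)) _))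
  ... | yes refl | no _     = ⌊v≟v⌋∧ v _
  ... | no _     | yes refl = ⌊v≟v⌋∧ v _
  ... | no _     | no _     = adjCopies-diagonal v x y

  inner-step : ∀ {v} s t → Inner v s → adĵ s t ≡ true → t ≢ inj₁ v → Inner v t
  inner-step (inj₂ (v , _ , _)) (inj₁ u) refl with u ≟ v
  ... | yes refl = λ _ u≢u → ⊥-elim (u≢u refl)
  ... | no _     = λ ()
  inner-step (inj₂ (v , _ , _)) (inj₂ (w , _ , _)) refl with v ≟ w
  ... | yes refl = λ _ _ → refl
  ... | no _     = λ ()

  inner-walk : ∀ {v s t} → Walk adĵ (λ r → r ≢ inj₁ v) s t → Inner v s → Inner v t
  inner-walk (here _)                inner = inner
  inner-walk (step {_} {w} _ e walk) inner =
    inner-walk walk (inner-step _ w inner e (Walk-start walk))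

  induced-meeting-inner⇒attached : ∀ {H} → TwoConnected H →
    {f : Fin (size H) → V} → IsInducedEmb (adj H) adĵ f →
    ∀ {v x₀} → Inner v (f x₀) → ∀ y → ∃[ x ] f y ≡ ι v x
  induced-meeting-inner⇒attached {H} tc {f} (f-inj , f-adj) {v} {x₀} inner y
    with f y ≟inj₁ v
  ... | yes fy≡v = base (Att v) , trans fy≡v (sym (ι-base v))
  ... | no fy≢v  = inner⇒attached (f y) (inner-walk (Walk-map f edge id walk) inner)
    where
    edge : ∀ {x x′} → adj H x x′ ≡ true → adĵ (f x) (f x′) ≡ true
    edge {x} {x′} e = trans (f-adj x x′) e

    walk : Walk (adj H) (λ w → f w ≢ inj₁ v) x₀ y
    walk = TwoConnected⇒walk-avoiding {H} tc (λ w → f w ≡ inj₁ v) (λ w → f w ≟inj₁ v)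
             (λ fz≡v fz′≡v → f-inj (trans fz≡v (sym fz′≡v)))
             x₀ y (λ fx₀≡v → subst (Inner v) fx₀≡v inner) fy≢v

  induced-avoiding-inner⇒embeds : ∀ {H} {f : Fin (size H) → V} →
    IsInducedEmb (adj H) adĵ f → (∀ x → ¬ (∃[ v ] Inner v (f x))) → Embeds H (ugraph G)
  induced-avoiding-inner⇒embeds {f = f} emb avoids
    with factor-induced {c = adĵ} inj₁ (λ _ _ → refl) (λ x → ¬inner⇒inj₁ (f x) (avoids x)) emb
  ... | g , _ , g-emb = g , g-emb

  attached-copy : ∀ {i} {f : Fin (size (graph (F i))) → V} {v}
                    (g : Fin (size (graph (F i))) → Fin (size (graph (Att v)))) →
                  i ≡ toℕ (col G v) → (∀ x → f x ≡ ι v (g x)) →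
                  Injective _≡_ _≡_ g → IsAttachedCopy i f
  attached-copy {f = f} {v} g refl f≗ιg g-inj = v , refl , (λ x → g x , f≗ιg x) , onto
    where
    onto : ∀ y → ∃[ x ] ι v y ≡ f x
    onto y with injective⇒surjective g g-inj y
    ... | x , gx≡y = x , trans (cong (ι v) (sym gx≡y)) (sym (f≗ιg x))

  induced-meeting-inner⇒attached-copy : (∀ i → TwoConnected (graph (F i))) → Antichain F →
    ∀ {i} {f : Fin (size (graph (F i))) → V} → IsInducedEmb (adj (graph (F i))) adĵ f →
    ∀ {v x₀} → Inner v (f x₀) → IsAttachedCopy i f
  induced-meeting-inner⇒attached-copy tc ac {i} emb {v} inner
    with factor-induced {c = adĵ} (ι v) (ι-adj v)
           (induced-meeting-inner⇒attached {graph (F i)} (tc i) emb inner) emb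
  ... | g , f≗ιg , g-emb =
    attached-copy g (Antichain⇒index-≡ {F} ac (g , g-emb)) f≗ιg (proj₁ g-emb)

lemma4p5 : (F : Family)
           → (∀ i → TwoConnected (graph (F i)))
           → Antichain F
           → (∀ i → BaseRigid (F i))
           → (k : ℕ) (G : ColGraph k)
           → InCstar F G
           → (i : ℕ) (f : Fin (size (graph (F i))) → Hat.V F G)
           → IsInducedEmb (adj (graph (F i))) (Hat.adĵ F G) f
           → Hat.IsAttachedCopy F G i f
lemma4p5 F tc ac _ _ G G∈C* i f emb = copy-is-attached
  where
  open Hat F G
  open HatProperties F G

  copy-is-attached : IsAttachedCopy i f
  copy-is-attached with any? (λ x → inner? (f x))
  ... | no none =
    ⊥-elim (G∈C* i (induced-avoiding-inner⇒embeds {graph (F i)} emb (λ x inner → none (x , inner))))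
  ... | yes (_ , _ , inner) = induced-meeting-inner⇒attached-copy tc ac emb inner
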